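{- For all $t_1,t_2,t_3\in\mathbb{Z}$, the elliptic curve $E(t_1,t_2,t_3)/\mathbb{Q}$ defined by the Weierstrass equation $y^2=(x-64t_1)(x-(1+64t_2))(x-(17+64t_3))$ has good reduction at the prime $2$. -}

module Defs where

open import Data.Nat using (ℕ)
open import Data.Nat.Divisibility using (_∣_)
open import Data.Integer as ℤ using (ℤ; ∣_∣)
open import Data.Rational using (ℚ; _+_; _*_; _-_; -_; ↥_; ↧ₙ_; _/_; 0ℚ)
open import Data.Product using (_×_; Σ; ∃)
open import Relation.Nullary using (¬_)
open import Relation.Binary.PropositionalEquality using (_≡_)

ι : ℤ → ℚ
ι n = n / 1

-- Generalised Weierstrass equation over ℚ:
--   y^2 + a1 x y + a3 y = x^3 + a2 x^2 + a4 x + a6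
record Weierstrass : Set where
  constructor weierstrass
  field
    a1 a2 a3 a4 a6 : ℚ

open Weierstrass public

-- Standard quantities (Silverman III.1)
module _ (E : Weierstrass) where
  b2 b4 b6 b8 Δ : ℚ
  b2 = a1 E * a1 E + ι (ℤ.+ 4) * a2 E
  b4 = ι (ℤ.+ 2) * a4 E + a1 E * a3 E
  b6 = a3 E * a3 E + ι (ℤ.+ 4) * a6 E
  b8 = a1 E * a1 E * a6 E + ι (ℤ.+ 4) * a2 E * a6 E - a1 E * a3 E * a4 E
       + a2 E * a3 E * a3 E - a4 E * a4 E
  Δ = - (b2 * b2 * b8) - ι (ℤ.+ 8) * b4 * b4 * b4
      - ι (ℤ.+ 27) * b6 * b6 + ι (ℤ.+ 9) * b2 * b4 * b6

-- E' is obtained from E by the admissible change of variables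
--   x = u^2 x' + r ,  y = u^3 y' + s u^2 x' + t   (u ≠ 0)
-- (Silverman, Table 3.1).
IsChangeOfVars : Weierstrass → Weierstrass → ℚ → ℚ → ℚ → ℚ → Set
IsChangeOfVars E E' u r s t =
  ¬ (u ≡ 0ℚ) ×
  (u * a1 E' ≡ a1 E + ι (ℤ.+ 2) * s) ×
  (u * u * a2 E' ≡ a2 E - s * a1 E + ι (ℤ.+ 3) * r - s * s) ×
  (u * u * u * a3 E' ≡ a3 E + r * a1 E + ι (ℤ.+ 2) * t) ×
  (u * u * u * u * a4 E' ≡
     a4 E - s * a3 E + ι (ℤ.+ 2) * r * a2 E - (t + r * s) * a1 E
     + ι (ℤ.+ 3) * r * r - ι (ℤ.+ 2) * s * t) ×
  (u * u * u * u * u * u * a6 E' ≡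
     a6 E + r * a4 E + r * r * a2 E + r * r * r - t * a3 E - t * t - r * t * a1 E)

Isomorphic : Weierstrass → Weierstrass → Set
Isomorphic E E' = Σ ℚ λ u → Σ ℚ λ r → Σ ℚ λ s → Σ ℚ λ t → IsChangeOfVars E E' u r s t

IsIntegralAt : ℕ → ℚ → Set
IsIntegralAt p q = ¬ (p ∣ ↧ₙ q)

IsUnitAt : ℕ → ℚ → Set
IsUnitAt p q = ¬ (p ∣ ↧ₙ q) × ¬ (p ∣ ∣ ↥ q ∣)

HasGoodReductionAt : ℕ → Weierstrass → Set
HasGoodReductionAt p E =
  ∃ λ E' → Isomorphic E E' ×
    IsIntegralAt p (a1 E') × IsIntegralAt p (a2 E') × IsIntegralAt p (a3 E') ×
    IsIntegralAt p (a4 E') × IsIntegralAt p (a6 E') × IsUnitAt p (Δ E')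

-- y^2 = (x - e1)(x - e2)(x - e3), expanded into Weierstrass form
fromRoots : ℚ → ℚ → ℚ → Weierstrass
fromRoots e1 e2 e3 = weierstrass 0ℚ (- (e1 + e2 + e3)) 0ℚ
  (e1 * e2 + e1 * e3 + e2 * e3) (- (e1 * e2 * e3))

E : ℤ → ℤ → ℤ → Weierstrass
E t1 t2 t3 = fromRoots (ι (ℤ.+ 64 ℤ.* t1)) (ι (ℤ.+ 1 ℤ.+ ℤ.+ 64 ℤ.* t2))
  (ι (ℤ.+ 17 ℤ.+ ℤ.+ 64 ℤ.* t3))

{-# OPTIONS --safe #-}
module Submission where

-- Substituting x = 4x′ + 1, y = 8y′ + 4x′ (u = 2, r = s = 1, t = 0) turns
-- y² = f(x) = (x − e₁)(x − e₂)(x − e₃) into y′² + x′y′ = x′³ + a₂′x′² + a₄′x′ + a₆′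
-- with 4a₂′ = 2 − (e₁ + e₂ + e₃), 16a₄′ = f′(1) and 64a₆′ = f(1).  The congruences
-- e₁ ≡ 0, e₂ ≡ 1, e₃ ≡ 17 (mod 64) make these coefficients integers, with a₄′ odd
-- and a₆′ even.  For a model with a₁ = 1 and a₃ = 0 one has Δ ≡ a₄² − a₆ (mod 2),
-- so the new model has odd discriminant.

open import Defs
open import Agda.Builtin.FromNat using (Number; fromNat)
open import Level using (0ℓ)
open import Data.Unit.Base using (tt)
open import Data.Product using (_,_)
open import Function using (_∘_)
open import Data.Nat as ℕ using (ℕ)
open import Data.Nat.Divisibility using (_∣_; ∣1⇒≡1)
import Data.Nat.Literals
open import Data.Integer as ℤ using (ℤ; +_; -[1+_])
import Data.Integer.Literals
open import Data.Integer.Properties using (*-identityʳ)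
open import Data.Integer.Divisibility.Signed using (∣ᵤ⇒∣; ∣⇒∣ᵤ; ∣m+n∣n⇒∣m; ∣m⇒∣m*n; ∣-refl)
open import Data.Integer.Tactic.RingSolver as ℤ-Solver using ()
open import Data.Rational as ℚ using (ℚ; 0ℚ; 1ℚ)
open import Data.Rational.Literals using (fromℤ)
open import Data.Rational.Properties using (↥p/↧p≡p; +-*-commutativeRing; _≟_)
open import Relation.Nullary using (¬_)
open import Relation.Nullary.Decidable using (dec⇒maybe)
open import Relation.Binary.PropositionalEquality
open import Tactic.RingSolver using (solve-∀)
import Tactic.RingSolver.Core.AlmostCommutativeRing as ACR

instance
  ℕ-number : Number ℕ
  ℕ-number = Data.Nat.Literals.number

  ℤ-number : Number ℤ
  ℤ-number = Data.Integer.Literals.number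

  ℚ-number : Number ℚ
  ℚ-number = Data.Rational.Literals.number

ℚ-ring : ACR.AlmostCommutativeRing 0ℓ 0ℓ
ℚ-ring = ACR.fromCommutativeRing +-*-commutativeRing (λ x → dec⇒maybe (0ℚ ≟ x))

ι≡fromℤ : ∀ n → ι n ≡ fromℤ n
ι≡fromℤ n = ↥p/↧p≡p (fromℤ n)

ι-+ : ∀ m n → ι (m ℤ.+ n) ≡ ι m ℚ.+ ι n
ι-+ m n = begin
  ι (m ℤ.+ n)                   ≡⟨ cong ι (cong₂ ℤ._+_ (*-identityʳ m) (*-identityʳ n)) ⟨
  ι (m ℤ.* 1 ℤ.+ n ℤ.* 1)       ≡⟨⟩
  fromℤ m ℚ.+ fromℤ n           ≡⟨ cong₂ ℚ._+_ (ι≡fromℤ m) (ι≡fromℤ n) ⟨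
  ι m ℚ.+ ι n                   ∎
  where open ≡-Reasoning

ι-* : ∀ m n → ι (m ℤ.* n) ≡ ι m ℚ.* ι n
ι-* m n = sym (cong₂ ℚ._*_ (ι≡fromℤ m) (ι≡fromℤ n))

ι-neg : ∀ n → ι (ℤ.- n) ≡ ℚ.- ι n
ι-neg n = trans (ι≡fromℤ (ℤ.- n)) (trans (fromℤ-neg n) (cong ℚ.-_ (sym (ι≡fromℤ n))))
  where
  fromℤ-neg : ∀ n → fromℤ (ℤ.- n) ≡ ℚ.- fromℤ n
  fromℤ-neg (+ 0)       = refl
  fromℤ-neg (+ ℕ.suc n) = refl
  fromℤ-neg -[1+ n ]    = refl

ι-- : ∀ m n → ι (m ℤ.- n) ≡ ι m ℚ.- ι n
ι-- m n = trans (ι-+ m (ℤ.- n)) (cong (ι m ℚ.+_) (ι-neg n))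

-- ⟦ e ⟧ unfolds to exactly the ℚ-term that e spells out, so a ℚ-goal built from
-- images of integers is met by some ⟦ e ⟧ up to conversion and then reduced to an
-- identity in ℤ by ⟦⟧≡ι⟦⟧ℤ.
infixl 6 _⊕_ _⊖_
infixl 7 _⊗_

data Expr : Set where
  ⌜_⌝         : ℤ → Expr
  _⊕_ _⊖_ _⊗_ : Expr → Expr → Expr

⟦_⟧ : Expr → ℚ
⟦ ⌜ n ⌝ ⟧ = ι n
⟦ e ⊕ f ⟧ = ⟦ e ⟧ ℚ.+ ⟦ f ⟧
⟦ e ⊖ f ⟧ = ⟦ e ⟧ ℚ.- ⟦ f ⟧
⟦ e ⊗ f ⟧ = ⟦ e ⟧ ℚ.* ⟦ f ⟧

⟦_⟧ℤ : Expr → ℤ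
⟦ ⌜ n ⌝ ⟧ℤ = n
⟦ e ⊕ f ⟧ℤ = ⟦ e ⟧ℤ ℤ.+ ⟦ f ⟧ℤ
⟦ e ⊖ f ⟧ℤ = ⟦ e ⟧ℤ ℤ.- ⟦ f ⟧ℤ
⟦ e ⊗ f ⟧ℤ = ⟦ e ⟧ℤ ℤ.* ⟦ f ⟧ℤ

⟦⟧≡ι⟦⟧ℤ : ∀ e → ⟦ e ⟧ ≡ ι ⟦ e ⟧ℤ
⟦⟧≡ι⟦⟧ℤ ⌜ n ⌝   = refl
⟦⟧≡ι⟦⟧ℤ (e ⊕ f) = trans (cong₂ ℚ._+_ (⟦⟧≡ι⟦⟧ℤ e) (⟦⟧≡ι⟦⟧ℤ f)) (sym (ι-+ ⟦ e ⟧ℤ ⟦ f ⟧ℤ))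
⟦⟧≡ι⟦⟧ℤ (e ⊖ f) = trans (cong₂ ℚ._-_ (⟦⟧≡ι⟦⟧ℤ e) (⟦⟧≡ι⟦⟧ℤ f)) (sym (ι-- ⟦ e ⟧ℤ ⟦ f ⟧ℤ))
⟦⟧≡ι⟦⟧ℤ (e ⊗ f) = trans (cong₂ ℚ._*_ (⟦⟧≡ι⟦⟧ℤ e) (⟦⟧≡ι⟦⟧ℤ f)) (sym (ι-* ⟦ e ⟧ℤ ⟦ f ⟧ℤ))

ι-transfer : ∀ e f → ⟦ e ⟧ℤ ≡ ⟦ f ⟧ℤ → ⟦ e ⟧ ≡ ⟦ f ⟧
ι-transfer e f eq = trans (⟦⟧≡ι⟦⟧ℤ e) (trans (cong ι eq) (sym (⟦⟧≡ι⟦⟧ℤ f)))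

ι-isIntegralAt : ∀ {p} → p ≢ 1 → ∀ n → IsIntegralAt p (ι n)
ι-isIntegralAt p≢1 n = subst (IsIntegralAt _) (sym (ι≡fromℤ n)) (p≢1 ∘ ∣1⇒≡1)

ι-isUnitAt : ∀ {p} → p ≢ 1 → ∀ n → ¬ p ∣ ℤ.∣ n ∣ → IsUnitAt p (ι n)
ι-isUnitAt p≢1 n p∤n = subst (IsUnitAt _) (sym (ι≡fromℤ n)) (p≢1 ∘ ∣1⇒≡1 , p∤n)

xyModel : ℚ → ℚ → ℚ → Weierstrass
xyModel a2 a4 a6 = weierstrass 1ℚ a2 0ℚ a4 a6

module _ where
  open import Data.Rational using (_+_; _-_; _*_; -_)

  Δ-xyModel : ∀ a2 a4 a6 → let b2 = 1 + 4 * a2 in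
    Δ (xyModel a2 a4 a6) ≡
      b2 * b2 * a4 * a4 - b2 * b2 * b2 * a6 - 64 * a4 * a4 * a4 - 432 * a6 * a6 + 72 * b2 * a4 * a6
  Δ-xyModel = Δ-expanded
    where
    -- Δ (xyModel a2 a4 a6) written out, since the solver does not unfold definitions.
    Δ-expanded : ∀ a2 a4 a6 →
      let b2 = 1 * 1 + 4 * a2 ; b4 = 2 * a4 + 1 * 0 ; b6 = 0 * 0 + 4 * a6
          b8 = 1 * 1 * a6 + 4 * a2 * a6 - 1 * 0 * a4 + a2 * 0 * 0 - a4 * a4 in
      - (b2 * b2 * b8) - 8 * b4 * b4 * b4 - 27 * b6 * b6 + 9 * b2 * b4 * b6 ≡
        b2 * b2 * a4 * a4 - b2 * b2 * b2 * a6 - 64 * a4 * a4 * a4 - 432 * a6 * a6 + 72 * b2 * a4 * a6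
    Δ-expanded = solve-∀ ℚ-ring

  fromRoots-changeOfVars : ∀ e1 e2 e3 a2 a4 a6 →
    4 * a2 ≡ 2 - (e1 + e2 + e3) →
    16 * a4 ≡ (1 - e1) * (1 - e2) + (1 - e1) * (1 - e3) + (1 - e2) * (1 - e3) →
    64 * a6 ≡ (1 - e1) * (1 - e2) * (1 - e3) →
    IsChangeOfVars (fromRoots e1 e2 e3) (xyModel a2 a4 a6) 2 1 1 0
  fromRoots-changeOfVars e1 e2 e3 a2 a4 a6 eq2 eq4 eq6 =
    (λ ()) , refl , trans eq2 (a2-shift e1 e2 e3) , refl ,
    trans eq4 (a4-shift e1 e2 e3) , trans eq6 (a6-shift e1 e2 e3)
    where
    a2-shift : ∀ e1 e2 e3 → let a1 = 0 ; a2 = - (e1 + e2 + e3) ; r = 1 ; s = 1 in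
      2 - (e1 + e2 + e3) ≡ a2 - s * a1 + 3 * r - s * s
    a2-shift = solve-∀ ℚ-ring

    a4-shift : ∀ e1 e2 e3 →
      let a1 = 0 ; a2 = - (e1 + e2 + e3) ; a3 = 0 ; a4 = e1 * e2 + e1 * e3 + e2 * e3
          r = 1 ; s = 1 ; t = 0 in
      (1 - e1) * (1 - e2) + (1 - e1) * (1 - e3) + (1 - e2) * (1 - e3) ≡
        a4 - s * a3 + 2 * r * a2 - (t + r * s) * a1 + 3 * r * r - 2 * s * t
    a4-shift = solve-∀ ℚ-ring

    a6-shift : ∀ e1 e2 e3 →
      let a1 = 0 ; a2 = - (e1 + e2 + e3) ; a3 = 0 ; a4 = e1 * e2 + e1 * e3 + e2 * e3
          a6 = - (e1 * e2 * e3) ; r = 1 ; t = 0 in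
      (1 - e1) * (1 - e2) * (1 - e3) ≡
        a6 + r * a4 + r * r * a2 + r * r * r - t * a3 - t * t - r * t * a1
    a6-shift = solve-∀ ℚ-ring

module _ where
  open import Data.Integer using (_+_; _-_; _*_; -_; ∣_∣)

  2≢1 : _≢_ {A = ℕ} 2 1
  2≢1 ()

  2∤1+2* : ∀ k → ¬ 2 ∣ ∣ 1 + 2 * k ∣
  2∤1+2* k 2∣ = 2≢1 (∣1⇒≡1 (∣⇒∣ᵤ (∣m+n∣n⇒∣m {i = 2} {m = 1} (∣ᵤ⇒∣ 2∣) (∣m⇒∣m*n k ∣-refl))))

  -- b2 and a4 are odd and a6 is even, so b2 * b2 * a4 * a4 is the only odd term.
  Δ-xyModel-odd : ∀ a2 d c → let b2 = 1 + 4 * a2 ; a4 = 1 + 2 * d ; a6 = 2 * c in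
    b2 * b2 * a4 * a4 - b2 * b2 * b2 * a6 - 64 * a4 * a4 * a4 - 432 * a6 * a6 + 72 * b2 * a4 * a6 ≡
      1 + 2 * (4 * a2 + 8 * a2 * a2 + 2 * b2 * b2 * (d + d * d) - c * b2 * b2 * b2
               - 32 * a4 * a4 * a4 - 864 * c * c + 72 * b2 * a4 * c)
  Δ-xyModel-odd = ℤ-Solver.solve-∀

  xyModel-Δ-isUnitAt2 : ∀ a2 d c → IsUnitAt 2 (Δ (xyModel (ι a2) (ι (1 + 2 * d)) (ι (2 * c))))
  xyModel-Δ-isUnitAt2 a2 d c = subst (IsUnitAt 2) (sym Δ≡odd) (ι-isUnitAt 2≢1 (1 + 2 * k) (2∤1+2* k))
    where
    b o k : ℤ
    b = 1 + 4 * a2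
    o = 1 + 2 * d
    k = 4 * a2 + 8 * a2 * a2 + 2 * b * b * (d + d * d) - c * b * b * b
        - 32 * o * o * o - 864 * c * c + 72 * b * o * c

    b2ᴱ a4ᴱ a6ᴱ reducedᴱ : Expr
    b2ᴱ = ⌜ 1 ⌝ ⊕ ⌜ 4 ⌝ ⊗ ⌜ a2 ⌝
    a4ᴱ = ⌜ o ⌝
    a6ᴱ = ⌜ 2 * c ⌝
    reducedᴱ = b2ᴱ ⊗ b2ᴱ ⊗ a4ᴱ ⊗ a4ᴱ ⊖ b2ᴱ ⊗ b2ᴱ ⊗ b2ᴱ ⊗ a6ᴱ ⊖ ⌜ 64 ⌝ ⊗ a4ᴱ ⊗ a4ᴱ ⊗ a4ᴱ
               ⊖ ⌜ 432 ⌝ ⊗ a6ᴱ ⊗ a6ᴱ ⊕ ⌜ 72 ⌝ ⊗ b2ᴱ ⊗ a4ᴱ ⊗ a6ᴱ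

    Δ≡odd : Δ (xyModel (ι a2) (ι o) (ι (2 * c))) ≡ ι (1 + 2 * k)
    Δ≡odd = begin
      Δ (xyModel (ι a2) (ι o) (ι (2 * c))) ≡⟨ Δ-xyModel (ι a2) (ι o) (ι (2 * c)) ⟩
      ⟦ reducedᴱ ⟧                         ≡⟨ ⟦⟧≡ι⟦⟧ℤ reducedᴱ ⟩
      ι ⟦ reducedᴱ ⟧ℤ                      ≡⟨ cong ι (Δ-xyModel-odd a2 d c) ⟩
      ι (1 + 2 * k)                        ∎
      where open ≡-Reasoning

  ≅xyModel⇒hasGoodReductionAt2 : ∀ {W} a2 d c →
    Isomorphic W (xyModel (ι a2) (ι (1 + 2 * d)) (ι (2 * c))) → HasGoodReductionAt 2 W
  ≅xyModel⇒hasGoodReductionAt2 a2 d c W≅ =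
    _ , W≅ , ι-isIntegralAt 2≢1 1 , ι-isIntegralAt 2≢1 a2 , ι-isIntegralAt 2≢1 0 ,
    ι-isIntegralAt 2≢1 (1 + 2 * d) , ι-isIntegralAt 2≢1 (2 * c) , xyModel-Δ-isUnitAt2 a2 d c

  -- The coefficients a₂′, a₄′ = 1 + 2d′ and a₆′ = 2c′ of E(t₁,t₂,t₃) after
  -- x = 4x′ + 1, y = 8y′ + 4x′.
  a2′ d′ c′ : ℤ → ℤ → ℤ → ℤ
  a2′ t1 t2 t3 = - 4 - 16 * (t1 + t2 + t3)
  d′ t1 t2 t3 = 32 * t2 * (1 + 4 * t3) - 2 * t2 * (1 - 64 * t1) - 2 * t3 + 32 * t1 + 128 * t1 * t3 - 1
  c′ t1 t2 t3 = 8 * t2 * (1 - 64 * t1) * (1 + 4 * t3)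

  a2′-spec : ∀ t1 t2 t3 → let e1 = 64 * t1 ; e2 = 1 + 64 * t2 ; e3 = 17 + 64 * t3 in
    4 * (- 4 - 16 * (t1 + t2 + t3)) ≡ 2 - (e1 + e2 + e3)
  a2′-spec = ℤ-Solver.solve-∀

  a4′-spec : ∀ t1 t2 t3 → let e1 = 64 * t1 ; e2 = 1 + 64 * t2 ; e3 = 17 + 64 * t3 in
    16 * (1 + 2 * (32 * t2 * (1 + 4 * t3) - 2 * t2 * (1 - 64 * t1) - 2 * t3 + 32 * t1 + 128 * t1 * t3 - 1))
      ≡ (1 - e1) * (1 - e2) + (1 - e1) * (1 - e3) + (1 - e2) * (1 - e3)
  a4′-spec = ℤ-Solver.solve-∀

  a6′-spec : ∀ t1 t2 t3 → let e1 = 64 * t1 ; e2 = 1 + 64 * t2 ; e3 = 17 + 64 * t3 in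
    64 * (2 * (8 * t2 * (1 - 64 * t1) * (1 + 4 * t3))) ≡ (1 - e1) * (1 - e2) * (1 - e3)
  a6′-spec = ℤ-Solver.solve-∀

  E≅xyModel : ∀ t1 t2 t3 →
    Isomorphic (E t1 t2 t3) (xyModel (ι (a2′ t1 t2 t3)) (ι (1 + 2 * d′ t1 t2 t3)) (ι (2 * c′ t1 t2 t3)))
  E≅xyModel t1 t2 t3 =
    2 , 1 , 1 , 0 , fromRoots-changeOfVars ⟦ e₁ ⟧ ⟦ e₂ ⟧ ⟦ e₃ ⟧ ⟦ a2ᴱ ⟧ ⟦ a4ᴱ ⟧ ⟦ a6ᴱ ⟧
    (ι-transfer (⌜ 4 ⌝ ⊗ a2ᴱ) (⌜ 2 ⌝ ⊖ (e₁ ⊕ e₂ ⊕ e₃)) (a2′-spec t1 t2 t3))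
    (ι-transfer (⌜ 16 ⌝ ⊗ a4ᴱ) (f₁ ⊗ f₂ ⊕ f₁ ⊗ f₃ ⊕ f₂ ⊗ f₃) (a4′-spec t1 t2 t3))
    (ι-transfer (⌜ 64 ⌝ ⊗ a6ᴱ) (f₁ ⊗ f₂ ⊗ f₃) (a6′-spec t1 t2 t3))
    where
    a2ᴱ a4ᴱ a6ᴱ e₁ e₂ e₃ f₁ f₂ f₃ : Expr
    a2ᴱ = ⌜ a2′ t1 t2 t3 ⌝
    a4ᴱ = ⌜ 1 + 2 * d′ t1 t2 t3 ⌝
    a6ᴱ = ⌜ 2 * c′ t1 t2 t3 ⌝
    e₁ = ⌜ 64 * t1 ⌝
    e₂ = ⌜ 1 + 64 * t2 ⌝
    e₃ = ⌜ 17 + 64 * t3 ⌝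
    f₁ = ⌜ 1 ⌝ ⊖ e₁
    f₂ = ⌜ 1 ⌝ ⊖ e₂
    f₃ = ⌜ 1 ⌝ ⊖ e₃

lemma4p2 : (t1 t2 t3 : ℤ) → HasGoodReductionAt 2 (E t1 t2 t3)
lemma4p2 t1 t2 t3 =
  ≅xyModel⇒hasGoodReductionAt2 {E t1 t2 t3} (a2′ t1 t2 t3) (d′ t1 t2 t3) (c′ t1 t2 t3)
    (E≅xyModel t1 t2 t3)
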